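{- Let $(\mathcal{T},\beta)$ be a modular decomposition of minimum width of a graph $G$ such that the quotient graph $\beta(x)$ is prime for every node $x$ of $\mathcal{T}$. Then the maximum modular degree of $(\mathcal{T},\beta)$ equals $\Delta_{\mathrm{md}}(G)$.
   Context: A modular decomposition $(\mathcal{T},\beta)$ of $G$ is a rooted tree $\mathcal{T}$ whose leaves correspond bijectively to the vertices of $G$; each node $x$ has the set $V_x$ of vertices at leaves below it and a quotient graph $\beta(x)$ (for a leaf, the single-vertex graph; for an internal node, a graph whose vertex set is the set of children of $x$) such that for distinct children $y,z$ of $x$: $y,z$ are adjacent in $\beta(x)$ iff every vertex of $V_y$ is adjacent in $G$ to every vertex of $V_z$, and non-adjacent iff no edge of $G$ joins $V_y$ and $V_z$. Its width is the maximum number of vertices of a quotient graph. A quotient graph $\beta(x)$ is prime if there is no set $A\subsetneq V(\beta(x))$ with $|A|\ge 2$ such that all vertices of $A$ have the same neighborhood in $V(\beta(x))\setminus A$. The maximum modular degree of $(\mathcal{T},\beta)$ is the maximum over all nodes $x$ of the maximum degree of $\beta(x)$; $\Delta_{\mathrm{md}}(G)$ is the minimum maximum modular degree over all modular decompositions of $G$. -}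

module Defs where

open import Data.Nat using (ℕ; zero; suc; _⊔_; _≤_)
open import Data.Fin using (Fin)
open import Data.Fin.Subset using (Subset; ∣_∣; _∈_; _∉_; ⊤)
open import Data.Bool using (Bool; true; false)
open import Data.List using (List; []; _∷_; map; foldr; allFin; concatMap)
import Data.List.Membership.Propositional as LM
open import Data.List.Relation.Binary.Permutation.Propositional using (_↭_)
open import Data.Vec using (tabulate)
open import Data.Product using (_×_; Σ; ∃; _,_)
open import Data.Unit using () renaming (⊤ to Unit)
open import Relation.Binary.PropositionalEquality using (_≡_; _≢_)
open import Relation.Nullary using (¬_)
open import Function.Bundles using (_⇔_)

SimpleAdj : (k : ℕ) → (Fin k → Fin k → Bool) → Set
SimpleAdj k adj = (∀ i j → adj i j ≡ adj j i) × (∀ i → adj i i ≡ false)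

record Graph : Set where
  field
    n      : ℕ
    adj    : Fin n → Fin n → Bool
    simple : SimpleAdj n adj

maxOver : (k : ℕ) → (Fin k → ℕ) → ℕ
maxOver k f = foldr _⊔_ 0 (map f (allFin k))

degree : {k : ℕ} → (Fin k → Fin k → Bool) → Fin k → ℕ
degree adj i = ∣ tabulate (adj i) ∣

maxDegree : (k : ℕ) → (Fin k → Fin k → Bool) → ℕ
maxDegree k adj = maxOver k (degree adj)

IsModuleSet : (k : ℕ) → (Fin k → Fin k → Bool) → Subset k → Set
IsModuleSet k adj A = ∀ a b v → a ∈ A → b ∈ A → v ∉ A → adj a v ≡ adj b v

Prime : (k : ℕ) → (Fin k → Fin k → Bool) → Set
Prime k adj = ¬ (Σ (Subset k) λ A → (A ≢ ⊤) × (2 ≤ ∣ A ∣) × IsModuleSet k adj A)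

-- Rooted trees with leaves labelled by vertices of G (Fin n); an
-- internal node has (suc k) ≥ 1 children and carries its quotient graph
-- β(x) as a Boolean adjacency on its children Fin (suc k).
data MDTree (n : ℕ) : Set where
  leaf : Fin n → MDTree n
  node : (k : ℕ) → (Fin (suc k) → MDTree n) → (Fin (suc k) → Fin (suc k) → Bool) → MDTree n

leaves : {n : ℕ} → MDTree n → List (Fin n)
leaves (leaf v) = v ∷ []
leaves (node k ch q) = concatMap (λ i → leaves (ch i)) (allFin (suc k))

module _ (G : Graph) where
  open Graph G

  Complete : List (Fin n) → List (Fin n) → Set
  Complete X Y = ∀ u v → u LM.∈ X → v LM.∈ Y → adj u v ≡ true

  Anticomplete : List (Fin n) → List (Fin n) → Set
  Anticomplete X Y = ∀ u v → u LM.∈ X → v LM.∈ Y → adj u v ≡ false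

  ValidNodes : MDTree n → Set
  ValidNodes (leaf v) = Unit
  ValidNodes (node k ch q) =
    (∀ i → ValidNodes (ch i)) ×
    SimpleAdj (suc k) q ×
    (∀ i j → i ≢ j →
      ((q i j ≡ true) ⇔ Complete (leaves (ch i)) (leaves (ch j))) ×
      ((q i j ≡ false) ⇔ Anticomplete (leaves (ch i)) (leaves (ch j))))

  IsModularDecomposition : MDTree n → Set
  IsModularDecomposition T = (leaves T ↭ allFin n) × ValidNodes T

width : {n : ℕ} → MDTree n → ℕ
width (leaf v) = 1
width (node k ch q) = suc k ⊔ maxOver (suc k) (λ i → width (ch i))

maxModDegree : {n : ℕ} → MDTree n → ℕ
maxModDegree (leaf v) = 0
maxModDegree (node k ch q) =
  maxDegree (suc k) q ⊔ maxOver (suc k) (λ i → maxModDegree (ch i))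

AllPrime : {n : ℕ} → MDTree n → Set
AllPrime (leaf v) = Prime 1 (λ _ _ → false)
AllPrime (node k ch q) = Prime (suc k) q × (∀ i → AllPrime (ch i))

MinimumWidth : (G : Graph) → MDTree (Graph.n G) → Set
MinimumWidth G T = ∀ T′ → IsModularDecomposition G T′ → width T ≤ width T′

IsΔmd : Graph → ℕ → Set
IsΔmd G d =
  (∃ λ T → IsModularDecomposition G T × maxModDegree T ≡ d) ×
  (∀ T → IsModularDecomposition G T → d ≤ maxModDegree T)

{-# OPTIONS --safe #-}
-- Picking one vertex below each child shows that every quotient graph β(x) of a modular
-- decomposition is an induced subgraph of G. Conversely, let H be a prime induced subgraph of G
-- and walk down any other decomposition T′ as long as H lies below a single child. At the node
-- where this stops, the vertices of H below any one child form a proper module of H, hence by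
-- primality a single vertex, so H is an induced subgraph of that node's quotient graph and its
-- degrees are bounded by the maximum modular degree of T′. Applying this to the prime quotient
-- graphs of T proves optimality.
module Submission where

open import Defs
open import Data.Bool using (Bool; true; false)
open import Data.Fin using (Fin; zero; suc)
open import Data.Fin.Properties using (_≟_; all?; ¬∀⟶∃¬; suc-injective; 0≢1+n)
open import Data.Fin.Subset using (Subset; ∣_∣; _∈_; ⊤; ⊥; _-_; inside; outside)
open import Data.Fin.Subset.Properties
  using (∈⊤; x∈p∧x≢y⇒x∈p-y; x∈p⇒∣p-x∣<∣p∣; p⊆q⇒∣p∣≤∣q∣; ∣⊥∣≡0)
open import Data.List using (allFin)
import Data.List.Membership.Propositional as List
open import Data.List.Membership.Propositional.Properties
  using (∈-concatMap⁺; ∈-concatMap⁻; ∈-allFin)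
open import Data.List.Properties using (foldr-preservesᵒ; foldr-preservesᵇ)
open import Data.List.Relation.Unary.Any using (here; there; satisfied)
import Data.List.Relation.Unary.Any.Properties as Any
import Data.List.Relation.Unary.All.Properties as All
open import Data.List.Relation.Binary.Permutation.Propositional using (↭-sym)
open import Data.List.Relation.Binary.Permutation.Propositional.Properties using (∈-resp-↭)
open import Data.Nat using (ℕ; suc; _≤_; _⊔_; z≤n; s≤s)
open import Data.Nat.Properties
  using (≤-refl; ≤-trans; ≤-reflexive; n≤0⇒n≡0; ⊔-lub; m≤m⊔n; m≤n⊔m; m≤n⇒m≤n⊔o; m≤n⇒m≤o⊔n)
open import Data.Product using (∃; _,_; proj₁; proj₂; map₂)
open import Data.Sum using (_⊎_; inj₁; inj₂; [_,_]′)
open import Data.Vec using ([]; _∷_; here; there; tabulate)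
open import Data.Vec.Properties using (lookup∘tabulate; []=⇒lookup; lookup⇒[]=)
open import Function.Base using (id)
open import Function.Bundles using (Equivalence)
open import Function.Definitions using (Injective)
open import Relation.Binary.PropositionalEquality
open import Relation.Nullary using (does; yes; no; contradiction)
open import Relation.Nullary.Decidable using (dec-true)

∈-tabulate⁺ : ∀ {k} {f : Fin k → Bool} {x} → f x ≡ true → x ∈ tabulate f
∈-tabulate⁺ {f = f} {x} fx≡true = lookup⇒[]= x (tabulate f) (trans (lookup∘tabulate f x) fx≡true)

∈-tabulate⁻ : ∀ {k} {f : Fin k → Bool} {x} → x ∈ tabulate f → f x ≡ true
∈-tabulate⁻ {f = f} {x} x∈ = trans (sym (lookup∘tabulate f x)) ([]=⇒lookup x∈)

injective⇒∣p∣≤∣q∣ : ∀ {m k} {c : Fin m → Fin k} {p : Subset m} {q : Subset k} →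
  Injective _≡_ _≡_ c → (∀ {x} → x ∈ p → c x ∈ q) → ∣ p ∣ ≤ ∣ q ∣
injective⇒∣p∣≤∣q∣ {p = []} _ _ = z≤n
injective⇒∣p∣≤∣q∣ {p = outside ∷ p} c-inj c[p]⊆q =
  injective⇒∣p∣≤∣q∣ (λ eq → suc-injective (c-inj eq)) (λ x∈p → c[p]⊆q (there x∈p))
injective⇒∣p∣≤∣q∣ {c = c} {p = inside ∷ p} {q} c-inj c[p]⊆q =
  ≤-trans (s≤s (injective⇒∣p∣≤∣q∣ (λ eq → suc-injective (c-inj eq)) c[p]⊆q-c₀))
          (x∈p⇒∣p-x∣<∣p∣ (c[p]⊆q here))
  where
  c[p]⊆q-c₀ : ∀ {x} → x ∈ p → c (suc x) ∈ q - c zero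
  c[p]⊆q-c₀ x∈p = x∈p∧x≢y⇒x∈p-y (c[p]⊆q (there x∈p)) (λ eq → 0≢1+n (sym (c-inj eq)))

x∈p∧y∈p∧x≢y⇒2≤∣p∣ : ∀ {k} {p : Subset k} {x y} → x ∈ p → y ∈ p → x ≢ y → 2 ≤ ∣ p ∣
x∈p∧y∈p∧x≢y⇒2≤∣p∣ x∈p y∈p x≢y =
  ≤-trans (s≤s (≤-trans (s≤s z≤n) (x∈p⇒∣p-x∣<∣p∣ (x∈p∧x≢y⇒x∈p-y y∈p (≢-sym x≢y)))))
          (x∈p⇒∣p-x∣<∣p∣ x∈p)

f≤maxOver : ∀ {k} (f : Fin k → ℕ) i → f i ≤ maxOver k f
f≤maxOver f i =
  foldr-preservesᵒ {P = f i ≤_} {f = _⊔_} (λ x y → [ m≤n⇒m≤n⊔o y , m≤n⇒m≤o⊔n x ]′) 0 _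
    (inj₂ (Any.map⁺ (Any.tabulate⁺ i ≤-refl)))

maxOver≤ : ∀ {k} {f : Fin k → ℕ} {b} → (∀ i → f i ≤ b) → maxOver k f ≤ b
maxOver≤ {b = b} f≤b =
  foldr-preservesᵇ {P = _≤ b} {f = _⊔_} ⊔-lub z≤n (All.map⁺ (All.tabulate⁺ f≤b))

maxDegree-edgeless : ∀ {k} {H : Fin k → Fin k → Bool} →
  (∀ i j → H i j ≡ false) → maxDegree k H ≡ 0
maxDegree-edgeless {k} {H} edgeless = n≤0⇒n≡0 (maxOver≤ degree≤0)
  where
  degree≤0 : ∀ i → degree H i ≤ 0
  degree≤0 i = ≤-trans (p⊆q⇒∣p∣≤∣q∣ {q = ⊥} λ {j} j∈ →
                 contradiction (trans (sym (edgeless i j)) (∈-tabulate⁻ j∈)) λ ())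
               (≤-reflexive (∣⊥∣≡0 k))

maxDegree-mono-induced : ∀ {m k} {H : Fin m → Fin m → Bool} {K : Fin k → Fin k → Bool}
  {h : Fin m → Fin k} → Injective _≡_ _≡_ h → (∀ i j → H i j ≡ K (h i) (h j)) →
  maxDegree m H ≤ maxDegree k K
maxDegree-mono-induced {K = K} {h} h-inj H≡K = maxOver≤ λ i →
  ≤-trans (injective⇒∣p∣≤∣q∣ h-inj λ {j} j∈ → ∈-tabulate⁺ (trans (sym (H≡K i j)) (∈-tabulate⁻ j∈)))
          (f≤maxOver (degree K) (h i))

fibre : ∀ {m k} → (Fin m → Fin k) → Fin k → Subset m
fibre c y = tabulate λ x → does (c x ≟ y)

∈-fibre⁺ : ∀ {m k} (c : Fin m → Fin k) {x y} → c x ≡ y → x ∈ fibre c y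
∈-fibre⁺ c {x} {y} cx≡y = ∈-tabulate⁺ (dec-true (c x ≟ y) cx≡y)

∈-fibre⁻ : ∀ {m k} (c : Fin m → Fin k) {x y} → x ∈ fibre c y → c x ≡ y
∈-fibre⁻ c {x} {y} x∈ with c x ≟ y | ∈-tabulate⁻ x∈
... | yes cx≡y | _ = cx≡y

fibre-isModule : ∀ {m k} {H : Fin m → Fin m → Bool} (c : Fin m → Fin k) →
  (∀ {a b v} → c a ≡ c b → c v ≢ c a → H a v ≡ H b v) → ∀ y → IsModuleSet m H (fibre c y)
fibre-isModule c fibres-modular y a b v a∈ b∈ v∉ =
  fibres-modular (trans (∈-fibre⁻ c a∈) (sym (∈-fibre⁻ c b∈)))
                 (λ cv≡ca → v∉ (∈-fibre⁺ c (trans cv≡ca (∈-fibre⁻ c a∈))))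

prime⇒properModule-subsingleton : ∀ {m} {H : Fin m → Fin m → Bool} {A : Subset m} →
  Prime m H → IsModuleSet m H A → A ≢ ⊤ → ∀ {a b} → a ∈ A → b ∈ A → a ≡ b
prime⇒properModule-subsingleton prime A-module A≢⊤ {a} {b} a∈ b∈ with a ≟ b
... | yes a≡b = a≡b
... | no a≢b = contradiction (_ , A≢⊤ , x∈p∧y∈p∧x≢y⇒2≤∣p∣ a∈ b∈ a≢b , A-module) prime

prime⇒constant⊎injective : ∀ {m k} {H : Fin (suc m) → Fin (suc m) → Bool} →
  Prime (suc m) H → (c : Fin (suc m) → Fin k) →
  (∀ {a b v} → c a ≡ c b → c v ≢ c a → H a v ≡ H b v) →
  (∀ j → c j ≡ c zero) ⊎ Injective _≡_ _≡_ c
prime⇒constant⊎injective {m} prime c fibres-modular with all? (λ j → c j ≟ c zero)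
... | yes constant = inj₁ constant
... | no ¬constant = inj₂ λ {a} ca≡cb →
  prime⇒properModule-subsingleton prime (fibre-isModule c fibres-modular (c a))
    fibre≢⊤ (∈-fibre⁺ c refl) (∈-fibre⁺ c (sym ca≡cb))
  where
  apart : ∃ λ j → c j ≢ c zero
  apart = ¬∀⟶∃¬ (suc m) _ (λ j → c j ≟ c zero) ¬constant
  fibre≢⊤ : ∀ {y} → fibre c y ≢ ⊤
  fibre≢⊤ {y} F≡⊤ = proj₂ apart (trans (c≡y (proj₁ apart)) (sym (c≡y zero)))
    where
    c≡y : ∀ x → c x ≡ y
    c≡y x = ∈-fibre⁻ c (subst (x ∈_) (sym F≡⊤) ∈⊤)

∈-leaves-node⁺ : ∀ {n k} (ch : Fin (suc k) → MDTree n) (β : Fin (suc k) → Fin (suc k) → Bool) {x} i →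
  x List.∈ leaves (ch i) → x List.∈ leaves (node k ch β)
∈-leaves-node⁺ ch _ i x∈ =
  ∈-concatMap⁺ (λ j → leaves (ch j)) {xs = allFin _} (Any.tabulate⁺ {f = id} i x∈)

∈-leaves-node⁻ : ∀ {n k} (ch : Fin (suc k) → MDTree n) (β : Fin (suc k) → Fin (suc k) → Bool) {x} →
  x List.∈ leaves (node k ch β) → ∃ λ i → x List.∈ leaves (ch i)
∈-leaves-node⁻ ch _ x∈ = satisfied (∈-concatMap⁻ (λ j → leaves (ch j)) {xs = allFin _} x∈)

leaves-nonempty : ∀ {n} (T : MDTree n) → ∃ λ v → v List.∈ leaves T
leaves-nonempty (leaf v) = v , here refl
leaves-nonempty (node k ch β) = map₂ (∈-leaves-node⁺ ch β zero) (leaves-nonempty (ch zero))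

module _ (G : Graph) where
  open Graph G

  Induces : ∀ {m} → (Fin m → Fin n) → (Fin m → Fin m → Bool) → Set
  Induces s H = ∀ i j → adj (s i) (s j) ≡ H i j

  adj-across-children : ∀ {k ch β} → ValidNodes G (node k ch β) → ∀ {a b x y} → a ≢ b →
    x List.∈ leaves (ch a) → y List.∈ leaves (ch b) → adj x y ≡ β a b
  adj-across-children {β = β} (_ , _ , quotient) {a} {b} a≢b x∈ y∈ with β a b in βab
  ... | true  = Equivalence.to (proj₁ (quotient a b a≢b)) βab _ _ x∈ y∈
  ... | false = Equivalence.to (proj₂ (quotient a b a≢b)) βab _ _ x∈ y∈

  representatives-induce : ∀ {k ch β m} → ValidNodes G (node k ch β) →
    {s : Fin m → Fin n} {c : Fin m → Fin (suc k)} → Injective _≡_ _≡_ c →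
    (∀ i → s i List.∈ leaves (ch (c i))) → Induces s (λ i j → β (c i) (c j))
  representatives-induce valid@(_ , (_ , β-irrefl) , _) {s} {c} c-inj s∈ i j with i ≟ j
  ... | yes refl = trans (proj₂ simple (s i)) (sym (β-irrefl (c i)))
  ... | no i≢j   = adj-across-children valid (λ ci≡cj → i≢j (c-inj ci≡cj)) (s∈ i) (s∈ j)

  child-fibres-modular : ∀ {k ch β m} {H : Fin m → Fin m → Bool} → ValidNodes G (node k ch β) →
    {s : Fin m → Fin n} → Induces s H → {c : Fin m → Fin (suc k)} →
    (∀ i → s i List.∈ leaves (ch (c i))) →
    ∀ {a b v} → c a ≡ c b → c v ≢ c a → H a v ≡ H b v
  child-fibres-modular {β = β} {H = H} valid s-induces {c} s∈c {a} {b} {v} ca≡cb cv≢ca = begin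
    H a v          ≡⟨ H≡β (≢-sym cv≢ca) ⟩
    β (c a) (c v)  ≡⟨ cong (λ y → β y (c v)) ca≡cb ⟩
    β (c b) (c v)  ≡⟨ sym (H≡β (≢-sym (subst (c v ≢_) ca≡cb cv≢ca))) ⟩
    H b v          ∎
    where
    open ≡-Reasoning
    H≡β : ∀ {x y} → c x ≢ c y → H x y ≡ β (c x) (c y)
    H≡β {x} {y} cx≢cy =
      trans (sym (s-induces x y)) (adj-across-children valid cx≢cy (s∈c x) (s∈c y))

  prime⇒maxDegree≤maxModDegree : ∀ {m} {H : Fin (suc m) → Fin (suc m) → Bool} →
    Prime (suc m) H → {s : Fin (suc m) → Fin n} → Induces s H →
    (T : MDTree n) → ValidNodes G T → (∀ i → s i List.∈ leaves T) →
    maxDegree (suc m) H ≤ maxModDegree T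
  prime⇒maxDegree≤maxModDegree {H = H} _ {s} s-induces (leaf v) _ s∈ =
    ≤-reflexive (maxDegree-edgeless λ i j → begin
      H i j            ≡⟨ sym (s-induces i j) ⟩
      adj (s i) (s j)  ≡⟨ cong₂ adj (Any.singleton⁻ (s∈ i)) (Any.singleton⁻ (s∈ j)) ⟩
      adj v v          ≡⟨ proj₂ simple v ⟩
      false            ∎)
    where open ≡-Reasoning
  prime⇒maxDegree≤maxModDegree {m} {H} prime {s} s-induces (node k ch β) valid@(valid-ch , _) s∈ =
    [ within-one-child , spread-over-children ]′
      (prime⇒constant⊎injective prime c (child-fibres-modular valid s-induces s∈c))
    where
    c : Fin (suc m) → Fin (suc k)
    c i = proj₁ (∈-leaves-node⁻ ch β (s∈ i))
    s∈c : ∀ i → s i List.∈ leaves (ch (c i))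
    s∈c i = proj₂ (∈-leaves-node⁻ ch β (s∈ i))
    within-one-child : (∀ j → c j ≡ c zero) → maxDegree (suc m) H ≤ maxModDegree (node k ch β)
    within-one-child constant =
      ≤-trans (prime⇒maxDegree≤maxModDegree prime s-induces (ch (c zero)) (valid-ch (c zero))
                 (λ i → subst (λ y → s i List.∈ leaves (ch y)) (constant i) (s∈c i)))
              (≤-trans (f≤maxOver (λ j → maxModDegree (ch j)) (c zero))
                       (m≤n⊔m (maxDegree (suc k) β) _))
    spread-over-children : Injective _≡_ _≡_ c → maxDegree (suc m) H ≤ maxModDegree (node k ch β)
    spread-over-children c-inj =
      ≤-trans (maxDegree-mono-induced {K = β} c-inj λ i j →
                 trans (sym (s-induces i j)) (representatives-induce valid c-inj s∈c i j))
              (m≤m⊔n _ _)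

  maxModDegree-minimal : (T : MDTree n) → ValidNodes G T → AllPrime T →
    (T′ : MDTree n) → ValidNodes G T′ → (∀ v → v List.∈ leaves T′) →
    maxModDegree T ≤ maxModDegree T′
  maxModDegree-minimal (leaf _) _ _ _ _ _ = z≤n
  maxModDegree-minimal (node k ch β) valid@(valid-ch , _) (β-prime , ch-prime) T′ valid′ all∈T′ =
    ⊔-lub (prime⇒maxDegree≤maxModDegree {H = β} β-prime
             (representatives-induce valid id (λ i → proj₂ (leaves-nonempty (ch i))))
             T′ valid′ (λ i → all∈T′ _))
          (maxOver≤ λ i → maxModDegree-minimal (ch i) (valid-ch i) (ch-prime i) T′ valid′ all∈T′)

proposition34 : (G : Graph) (T : MDTree (Graph.n G)) →
    IsModularDecomposition G T → MinimumWidth G T → AllPrime T →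
    IsΔmd G (maxModDegree T)
proposition34 G T T-md@(_ , T-valid) _ T-prime =
  (T , T-md , refl) ,
  λ T′ (T′-perm , T′-valid) → maxModDegree-minimal G T T-valid T-prime T′ T′-valid
    (λ v → ∈-resp-↭ (↭-sym T′-perm) (∈-allFin v))
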